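{- Let $\Gamma\colon \mathsf{u}\ell\mathsf{M}\to\mathsf{MVM}$ be the functor described below and let $\Xi\colon\mathsf{MVM}\to\mathsf{u}\ell\mathsf{M}$ be a quasi-inverse of $\Gamma$. Then $\Gamma$ and $\Xi$ both preserve and reflect injectivity of morphisms: a morphism $f$ in $\mathsf{u}\ell\mathsf{M}$ is injective if and only if $\Gamma(f)$ is injective, and a morphism $g$ in $\mathsf{MVM}$ is injective if and only if $\Xi(g)$ is injective.
   Context: An MV-monoidal algebra is an algebra $\langle A,\oplus,\odot,\vee,\wedge,0,1\rangle$ (arities $2,2,2,2,0,0$) such that: (E1) $\langle A,\vee,\wedge\rangle$ is a distributive lattice; (E2) $\langle A,\oplus,0\rangle$ and $\langle A,\odot,1\rangle$ are commutative monoids; (E3) $\oplus$ and $\odot$ distribute over both $\vee$ and $\wedge$; (E4) $(x\oplus y)\odot((x\odot y)\oplus z)=(x\odot(y\oplus z))\oplus(y\odot z)$; (E5) $(x\odot y)\oplus((x\oplus y)\odot z)=(x\oplus(y\odot z))\odot(y\oplus z)$; (E6) $(x\odot y)\oplus z=((x\oplus y)\odot((x\odot y)\oplus z))\vee z$; (E7) $(x\oplus y)\odot z=((x\odot y)\oplus((x\oplus y)\odot z))\wedge z$. $\mathsf{MVM}$ is the category of MV-monoidal algebras and their homomorphisms. A unital commutative distributive $\ell$-monoid is an algebra $\langle M,+,\vee,\wedge,0,1,-1\rangle$ (arities $2,2,2,0,0,0$) such that: $\langle M,\vee,\wedge\rangle$ is a distributive lattice; $\langle M,+,0\rangle$ is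 a commutative monoid; $+$ distributes over $\vee$ and $\wedge$; $-1+1=0$; $-1\leq 0\leq 1$; and for every $x\in M$ there is $n\in\mathbb{N}\setminus\{0\}$ with $(-1)+\dots+(-1)\leq x\leq 1+\dots+1$ ($n$ summands each). $\mathsf{u}\ell\mathsf{M}$ is the category of these algebras and their homomorphisms. For such $\mathbf{M}$, $\Gamma(\mathbf{M})$ is the set $\{x\in M\mid 0\leq x\leq 1\}$ with $\vee,\wedge,0,1$ restricted, $x\oplus y=(x+y)\wedge 1$ and $x\odot y=(x+y+(-1))\vee 0$; it is an MV-monoidal algebra. For a morphism $f$, $\Gamma(f)$ is the restriction of $f$. It is known that $\Gamma$ is an equivalence of categories, so a quasi-inverse $\Xi$ exists. -}

module Defs where

open import Level using (0ℓ) renaming (suc to lsuc)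
open import Data.Nat.Base using (ℕ; zero; suc)
open import Data.Product.Base using (Σ; ∃; _×_; _,_; proj₁; proj₂)
open import Relation.Binary.Core using (Rel)
open import Relation.Binary.Bundles using (Poset)
open import Algebra.Core using (Op₂)
open import Algebra.Definitions using (_DistributesOver_)
open import Algebra.Structures using (IsCommutativeMonoid)
open import Algebra.Lattice.Structures using (IsDistributiveLattice)
open import Algebra.Lattice.Bundles using (Lattice)
import Algebra.Lattice.Properties.Lattice as LatticeProps
import Relation.Binary.Reasoning.PartialOrder as POR
import Relation.Binary.Reasoning.Setoid as SR

LeqOf : {A : Set} → Rel A 0ℓ → Op₂ A → Rel A 0ℓ
LeqOf _≈_ _∧_ x y = x ≈ (x ∧ y)

timesOf : {A : Set} → Op₂ A → A → ℕ → A → A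
timesOf _+_ 𝟘 zero    x = 𝟘
timesOf _+_ 𝟘 (suc n) x = x + timesOf _+_ 𝟘 n x

-- Unital commutative distributive ℓ-monoids (carriers are setoids)

record ULM : Set₁ where
  infixl 6 _+_
  infixr 7 _∧_
  infixr 6 _∨_
  infix  4 _≈_
  field
    Carrier : Set
    _≈_     : Rel Carrier 0ℓ
    _+_     : Op₂ Carrier
    _∨_     : Op₂ Carrier
    _∧_     : Op₂ Carrier
    𝟘       : Carrier
    𝟙       : Carrier
    -𝟙      : Carrier
    isDistributiveLattice : IsDistributiveLattice _≈_ _∨_ _∧_
    +-isCommutativeMonoid : IsCommutativeMonoid _≈_ _+_ 𝟘
    +-distrib-∨ : _DistributesOver_ _≈_ _+_ _∨_
    +-distrib-∧ : _DistributesOver_ _≈_ _+_ _∧_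
    -𝟙+𝟙≈𝟘  : (-𝟙 + 𝟙) ≈ 𝟘
    -𝟙≤𝟘    : LeqOf _≈_ _∧_ -𝟙 𝟘
    𝟘≤𝟙     : LeqOf _≈_ _∧_ 𝟘 𝟙
    bounded : ∀ x → ∃ λ n →
                LeqOf _≈_ _∧_ (timesOf _+_ 𝟘 (suc n) -𝟙) x
              × LeqOf _≈_ _∧_ x (timesOf _+_ 𝟘 (suc n) 𝟙)

  _≤_ : Rel Carrier 0ℓ
  _≤_ = LeqOf _≈_ _∧_

record ULMHom (M N : ULM) : Set where
  private
    module M = ULM M
    module N = ULM N
  field
    ⟦_⟧     : M.Carrier → N.Carrier
    cong    : ∀ {x y} → x M.≈ y → ⟦ x ⟧ N.≈ ⟦ y ⟧
    pres-+  : ∀ x y → ⟦ x M.+ y ⟧ N.≈ (⟦ x ⟧ N.+ ⟦ y ⟧)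
    pres-∨  : ∀ x y → ⟦ x M.∨ y ⟧ N.≈ (⟦ x ⟧ N.∨ ⟦ y ⟧)
    pres-∧  : ∀ x y → ⟦ x M.∧ y ⟧ N.≈ (⟦ x ⟧ N.∧ ⟦ y ⟧)
    pres-𝟘  : ⟦ M.𝟘 ⟧ N.≈ N.𝟘
    pres-𝟙  : ⟦ M.𝟙 ⟧ N.≈ N.𝟙
    pres--𝟙 : ⟦ M.-𝟙 ⟧ N.≈ N.-𝟙

ULMInjective : {M N : ULM} → ULMHom M N → Set
ULMInjective {M} {N} f =
  ∀ x y → ULM._≈_ N (ULMHom.⟦ f ⟧ x) (ULMHom.⟦ f ⟧ y) → ULM._≈_ M x y

-- MV-monoidal algebras (carriers are setoids)

record MVMSig : Set₁ where
  field
    Carrier : Set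
    _≈_     : Rel Carrier 0ℓ
    _⊕_     : Op₂ Carrier
    _⊙_     : Op₂ Carrier
    _∨_     : Op₂ Carrier
    _∧_     : Op₂ Carrier
    𝟘       : Carrier
    𝟙       : Carrier

record IsMVM (A : MVMSig) : Set where
  open MVMSig A
  field
    isDistributiveLattice : IsDistributiveLattice _≈_ _∨_ _∧_
    ⊕-isCommutativeMonoid : IsCommutativeMonoid _≈_ _⊕_ 𝟘
    ⊙-isCommutativeMonoid : IsCommutativeMonoid _≈_ _⊙_ 𝟙
    ⊕-distrib-∨ : _DistributesOver_ _≈_ _⊕_ _∨_
    ⊕-distrib-∧ : _DistributesOver_ _≈_ _⊕_ _∧_
    ⊙-distrib-∨ : _DistributesOver_ _≈_ _⊙_ _∨_
    ⊙-distrib-∧ : _DistributesOver_ _≈_ _⊙_ _∧_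
    E4 : ∀ x y z → ((x ⊕ y) ⊙ ((x ⊙ y) ⊕ z)) ≈ ((x ⊙ (y ⊕ z)) ⊕ (y ⊙ z))
    E5 : ∀ x y z → ((x ⊙ y) ⊕ ((x ⊕ y) ⊙ z)) ≈ ((x ⊕ (y ⊙ z)) ⊙ (y ⊕ z))
    E6 : ∀ x y z → ((x ⊙ y) ⊕ z) ≈ (((x ⊕ y) ⊙ ((x ⊙ y) ⊕ z)) ∨ z)
    E7 : ∀ x y z → ((x ⊕ y) ⊙ z) ≈ (((x ⊙ y) ⊕ ((x ⊕ y) ⊙ z)) ∧ z)

record MVMAlg : Set₁ where
  field
    sig   : MVMSig
    isMVM : IsMVM sig
  open MVMSig sig public

record MVMHom (A B : MVMSig) : Set where
  private
    module A = MVMSig A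
    module B = MVMSig B
  field
    ⟦_⟧    : A.Carrier → B.Carrier
    cong   : ∀ {x y} → A._≈_ x y → B._≈_ ⟦ x ⟧ ⟦ y ⟧
    pres-⊕ : ∀ x y → B._≈_ ⟦ A._⊕_ x y ⟧ (B._⊕_ ⟦ x ⟧ ⟦ y ⟧)
    pres-⊙ : ∀ x y → B._≈_ ⟦ A._⊙_ x y ⟧ (B._⊙_ ⟦ x ⟧ ⟦ y ⟧)
    pres-∨ : ∀ x y → B._≈_ ⟦ A._∨_ x y ⟧ (B._∨_ ⟦ x ⟧ ⟦ y ⟧)
    pres-∧ : ∀ x y → B._≈_ ⟦ A._∧_ x y ⟧ (B._∧_ ⟦ x ⟧ ⟦ y ⟧)
    pres-𝟘 : B._≈_ ⟦ A.𝟘 ⟧ B.𝟘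
    pres-𝟙 : B._≈_ ⟦ A.𝟙 ⟧ B.𝟙

MVMInjective : {A B : MVMSig} → MVMHom A B → Set
MVMInjective {A} {B} f =
  ∀ x y → MVMSig._≈_ B (MVMHom.⟦ f ⟧ x) (MVMHom.⟦ f ⟧ y) → MVMSig._≈_ A x y

module _ (A : MVMAlg) where
  private
    module A = MVMAlg A
    open IsDistributiveLattice (IsMVM.isDistributiveLattice A.isMVM)
      using (refl)

  MVMid : MVMHom A.sig A.sig
  MVMid = record
    { ⟦_⟧ = λ x → x ; cong = λ p → p
    ; pres-⊕ = λ _ _ → refl ; pres-⊙ = λ _ _ → refl ; pres-∨ = λ _ _ → refl
    ; pres-∧ = λ _ _ → refl ; pres-𝟘 = refl ; pres-𝟙 = refl }

MVM∘ : {A B : MVMSig} (C : MVMAlg) →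
       MVMHom B (MVMAlg.sig C) → MVMHom A B → MVMHom A (MVMAlg.sig C)
MVM∘ C g f = record
  { ⟦_⟧ = λ x → G.⟦ F.⟦ x ⟧ ⟧
  ; cong = λ p → G.cong (F.cong p)
  ; pres-⊕ = λ x y → trans (G.cong (F.pres-⊕ x y)) (G.pres-⊕ _ _)
  ; pres-⊙ = λ x y → trans (G.cong (F.pres-⊙ x y)) (G.pres-⊙ _ _)
  ; pres-∨ = λ x y → trans (G.cong (F.pres-∨ x y)) (G.pres-∨ _ _)
  ; pres-∧ = λ x y → trans (G.cong (F.pres-∧ x y)) (G.pres-∧ _ _)
  ; pres-𝟘 = trans (G.cong F.pres-𝟘) G.pres-𝟘
  ; pres-𝟙 = trans (G.cong F.pres-𝟙) G.pres-𝟙 }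
  where
  module G = MVMHom g
  module F = MVMHom f
  open IsDistributiveLattice (IsMVM.isDistributiveLattice (MVMAlg.isMVM C))
    using (trans)

ULMid : (M : ULM) → ULMHom M M
ULMid M = record
  { ⟦_⟧ = λ x → x ; cong = λ p → p
  ; pres-+ = λ _ _ → refl ; pres-∨ = λ _ _ → refl ; pres-∧ = λ _ _ → refl
  ; pres-𝟘 = refl ; pres-𝟙 = refl ; pres--𝟙 = refl }
  where open IsDistributiveLattice (ULM.isDistributiveLattice M) using (refl)

ULM∘ : {L M N : ULM} → ULMHom M N → ULMHom L M → ULMHom L N
ULM∘ {N = N} g f = record
  { ⟦_⟧ = λ x → G.⟦ F.⟦ x ⟧ ⟧
  ; cong = λ p → G.cong (F.cong p)
  ; pres-+ = λ x y → trans (G.cong (F.pres-+ x y)) (G.pres-+ _ _)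
  ; pres-∨ = λ x y → trans (G.cong (F.pres-∨ x y)) (G.pres-∨ _ _)
  ; pres-∧ = λ x y → trans (G.cong (F.pres-∧ x y)) (G.pres-∧ _ _)
  ; pres-𝟘 = trans (G.cong F.pres-𝟘) G.pres-𝟘
  ; pres-𝟙 = trans (G.cong F.pres-𝟙) G.pres-𝟙
  ; pres--𝟙 = trans (G.cong F.pres--𝟙) G.pres--𝟙 }
  where
  module G = ULMHom g
  module F = ULMHom f
  open IsDistributiveLattice (ULM.isDistributiveLattice N) using (trans)

module ULMFacts (M : ULM) where
  open ULM M
  open IsDistributiveLattice isDistributiveLattice
    using (isLattice; refl; sym; trans; ∧-cong; ∨-cong)
  open IsCommutativeMonoid +-isCommutativeMonoid
    using (comm; assoc; identityʳ; identityˡ) renaming (∙-cong to +-cong)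

  lattice : Lattice 0ℓ 0ℓ
  lattice = record { isLattice = isLattice }

  open LatticeProps lattice using (poset; ∨-∧-isOrderTheoreticLattice)
  import Relation.Binary.Lattice as R
  open R.IsLattice ∨-∧-isOrderTheoreticLattice public
    using (supremum; infimum)
  open Poset poset public using () renaming (trans to ≤-trans; refl to ≤-refl)
  open POR poset

  x∧y≤y : ∀ x y → (x ∧ y) ≤ y
  x∧y≤y x y = proj₁ (proj₂ (infimum x y))

  ∧-greatest : ∀ {x y z} → z ≤ x → z ≤ y → z ≤ (x ∧ y)
  ∧-greatest {x} {y} p q = proj₂ (proj₂ (infimum x y)) _ p q

  x≤x∨y : ∀ x y → x ≤ (x ∨ y)
  x≤x∨y x y = proj₁ (supremum x y)

  y≤x∨y : ∀ x y → y ≤ (x ∨ y)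
  y≤x∨y x y = proj₁ (proj₂ (supremum x y))

  ∨-least : ∀ {x y z} → x ≤ z → y ≤ z → (x ∨ y) ≤ z
  ∨-least {x} {y} p q = proj₂ (proj₂ (supremum x y)) _ p q

  +-monoʳ : ∀ z {x y} → x ≤ y → (z + x) ≤ (z + y)
  +-monoʳ z {x} {y} p =
    trans (+-cong refl p) (proj₁ +-distrib-∧ z x y)

  +-monoˡ : ∀ z {x y} → x ≤ y → (x + z) ≤ (y + z)
  +-monoˡ z {x} {y} p = begin
    x + z ≈⟨ comm x z ⟩
    z + x ≤⟨ +-monoʳ z p ⟩
    z + y ≈⟨ comm z y ⟩
    y + z ∎

  +-mono : ∀ {x y u v} → x ≤ y → u ≤ v → (x + u) ≤ (y + v)
  +-mono {x} {y} {u} {v} p q = ≤-trans (+-monoˡ u p) (+-monoʳ y q)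

  I : Carrier → Set
  I x = (𝟘 ≤ x) × (x ≤ 𝟙)

  I-𝟘 : I 𝟘
  I-𝟘 = ≤-refl , 𝟘≤𝟙

  I-𝟙 : I 𝟙
  I-𝟙 = 𝟘≤𝟙 , ≤-refl

  I-∧ : ∀ {x y} → I x → I y → I (x ∧ y)
  I-∧ {x} {y} (p , p′) (q , q′) = ∧-greatest p q , ≤-trans (x∧y≤y x y) q′

  I-∨ : ∀ {x y} → I x → I y → I (x ∨ y)
  I-∨ {x} {y} (p , p′) (q , q′) = ≤-trans p (x≤x∨y x y) , ∨-least p′ q′

  I-⊕ : ∀ {x y} → I x → I y → I ((x + y) ∧ 𝟙)
  I-⊕ {x} {y} (p , _) (q , _) =
    ∧-greatest (begin
        𝟘 ≈⟨ sym (identityʳ 𝟘) ⟩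
        𝟘 + 𝟘 ≤⟨ +-mono p q ⟩
        x + y ∎) 𝟘≤𝟙
    , x∧y≤y (x + y) 𝟙

  I-⊙ : ∀ {x y} → I x → I y → I ((x + y + -𝟙) ∨ 𝟘)
  I-⊙ {x} {y} (_ , p) (_ , q) =
    y≤x∨y (x + y + -𝟙) 𝟘
    , ∨-least (begin
        x + y + -𝟙     ≤⟨ +-monoˡ -𝟙 (+-mono p q) ⟩
        𝟙 + 𝟙 + -𝟙     ≈⟨ assoc 𝟙 𝟙 -𝟙 ⟩
        𝟙 + (𝟙 + -𝟙)   ≈⟨ +-cong refl (comm 𝟙 -𝟙) ⟩
        𝟙 + (-𝟙 + 𝟙)   ≈⟨ +-cong refl -𝟙+𝟙≈𝟘 ⟩
        𝟙 + 𝟘          ≈⟨ identityʳ 𝟙 ⟩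
        𝟙 ∎) 𝟘≤𝟙

  module _ {N : ULM} (f : ULMHom M N) where
    private module N = ULM N
    open ULMHom f
    open IsDistributiveLattice N.isDistributiveLattice
      using () renaming (trans to transN; sym to symN)

    hom-mono : ∀ {x y} → x ≤ y → ⟦ x ⟧ N.≤ ⟦ y ⟧
    hom-mono {x} {y} p = transN (cong p) (pres-∧ x y)

    hom-I : ∀ {x} → I x → (N.𝟘 N.≤ ⟦ x ⟧) × (⟦ x ⟧ N.≤ N.𝟙)
    hom-I {x} (p , q) =
        transN (symN pres-𝟘) (transN (hom-mono p) (N.isDistributiveLattice .IsDistributiveLattice.∧-cong pres-𝟘 (IsDistributiveLattice.refl N.isDistributiveLattice)))
      , transN (hom-mono q) (IsDistributiveLattice.∧-cong N.isDistributiveLattice (IsDistributiveLattice.refl N.isDistributiveLattice) pres-𝟙)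

ΓSig : ULM → MVMSig
ΓSig M = record
  { Carrier = Σ Carrier I
  ; _≈_ = λ a b → proj₁ a ≈ proj₁ b
  ; _⊕_ = λ a b → ((proj₁ a + proj₁ b) ∧ 𝟙) , I-⊕ (proj₂ a) (proj₂ b)
  ; _⊙_ = λ a b → ((proj₁ a + proj₁ b + -𝟙) ∨ 𝟘) , I-⊙ (proj₂ a) (proj₂ b)
  ; _∨_ = λ a b → (proj₁ a ∨ proj₁ b) , I-∨ (proj₂ a) (proj₂ b)
  ; _∧_ = λ a b → (proj₁ a ∧ proj₁ b) , I-∧ (proj₂ a) (proj₂ b)
  ; 𝟘 = 𝟘 , I-𝟘
  ; 𝟙 = 𝟙 , I-𝟙
  }
  where
  open ULM M
  open ULMFacts M

Γhom : {M N : ULM} → ULMHom M N → MVMHom (ΓSig M) (ΓSig N)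
Γhom {M} {N} f = record
  { ⟦_⟧ = λ a → ⟦ proj₁ a ⟧ , hom-I f (proj₂ a)
  ; cong = cong
  ; pres-⊕ = λ a b → trans (pres-∧ _ _)
                       (∧-cong (pres-+ (proj₁ a) (proj₁ b)) pres-𝟙)
  ; pres-⊙ = λ a b → trans (pres-∨ _ _)
                       (∨-cong (trans (pres-+ _ _)
                                 (+-cong (pres-+ (proj₁ a) (proj₁ b)) pres--𝟙))
                               pres-𝟘)
  ; pres-∨ = λ a b → pres-∨ (proj₁ a) (proj₁ b)
  ; pres-∧ = λ a b → pres-∧ (proj₁ a) (proj₁ b)
  ; pres-𝟘 = pres-𝟘
  ; pres-𝟙 = pres-𝟙
  }
  where
  open ULMHom f
  open ULMFacts M using (hom-I)
  open IsDistributiveLattice (ULM.isDistributiveLattice N)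
    using (trans; ∧-cong; ∨-cong)
  open IsCommutativeMonoid (ULM.+-isCommutativeMonoid N)
    using () renaming (∙-cong to +-cong)

-- Γ on objects as an MV-monoidal algebra, given the (known) fact that
-- Γ(M) satisfies (E1)–(E7).
module _ (ΓisMVM : (M : ULM) → IsMVM (ΓSig M)) where

  ΓAlg : ULM → MVMAlg
  ΓAlg M = record { sig = ΓSig M ; isMVM = ΓisMVM M }

  record QuasiInverse : Set₁ where
    field
      obj : MVMAlg → ULM
      hom : {A B : MVMAlg} → MVMHom (MVMAlg.sig A) (MVMAlg.sig B) →
            ULMHom (obj A) (obj B)
      hom-resp : {A B : MVMAlg} (f g : MVMHom (MVMAlg.sig A) (MVMAlg.sig B)) →
                 (∀ x → MVMAlg._≈_ B (MVMHom.⟦ f ⟧ x) (MVMHom.⟦ g ⟧ x)) →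
                 ∀ y → ULM._≈_ (obj B) (ULMHom.⟦ hom {A} {B} f ⟧ y) (ULMHom.⟦ hom {A} {B} g ⟧ y)
      hom-id : (A : MVMAlg) →
               ∀ y → ULM._≈_ (obj A) (ULMHom.⟦ hom {A} {A} (MVMid A) ⟧ y) y
      hom-∘ : {A B C : MVMAlg}
              (g : MVMHom (MVMAlg.sig B) (MVMAlg.sig C))
              (f : MVMHom (MVMAlg.sig A) (MVMAlg.sig B)) →
              ∀ y → ULM._≈_ (obj C) (ULMHom.⟦ hom {A} {C} (MVM∘ C g f) ⟧ y)
                                    (ULMHom.⟦ hom {B} {C} g ⟧ (ULMHom.⟦ hom {A} {B} f ⟧ y))

      η    : (A : MVMAlg) → MVMHom (MVMAlg.sig A) (ΓSig (obj A))
      η⁻¹  : (A : MVMAlg) → MVMHom (ΓSig (obj A)) (MVMAlg.sig A)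
      η⁻¹∘η : (A : MVMAlg) → ∀ x →
              MVMAlg._≈_ A (MVMHom.⟦ η⁻¹ A ⟧ (MVMHom.⟦ η A ⟧ x)) x
      η∘η⁻¹ : (A : MVMAlg) → ∀ y →
              MVMSig._≈_ (ΓSig (obj A)) (MVMHom.⟦ η A ⟧ (MVMHom.⟦ η⁻¹ A ⟧ y)) y
      η-natural : {A B : MVMAlg} (f : MVMHom (MVMAlg.sig A) (MVMAlg.sig B)) →
                  ∀ x → MVMSig._≈_ (ΓSig (obj B))
                          (MVMHom.⟦ η B ⟧ (MVMHom.⟦ f ⟧ x))
                          (MVMHom.⟦ Γhom (hom {A} {B} f) ⟧ (MVMHom.⟦ η A ⟧ x))

      ε    : (M : ULM) → ULMHom (obj (ΓAlg M)) M
      ε⁻¹  : (M : ULM) → ULMHom M (obj (ΓAlg M))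
      ε⁻¹∘ε : (M : ULM) → ∀ x →
              ULM._≈_ (obj (ΓAlg M)) (ULMHom.⟦ ε⁻¹ M ⟧ (ULMHom.⟦ ε M ⟧ x)) x
      ε∘ε⁻¹ : (M : ULM) → ∀ y →
              ULM._≈_ M (ULMHom.⟦ ε M ⟧ (ULMHom.⟦ ε⁻¹ M ⟧ y)) y
      ε-natural : {M N : ULM} (f : ULMHom M N) →
                  ∀ x → ULM._≈_ N
                          (ULMHom.⟦ ε N ⟧ (ULMHom.⟦ hom {ΓAlg M} {ΓAlg N} (Γhom f) ⟧ x))
                          (ULMHom.⟦ f ⟧ (ULMHom.⟦ ε M ⟧ x))

-- An element x of [0, n·1] in a unital ℓ-monoid is determined by x ∧ 1, which
-- lies in Γ(M), together with x ∨ 1 = ((x + (-1)) ∨ 0) + 1, whose truncation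
-- (x + (-1)) ∨ 0 lies in [0, (n-1)·1]: a distributive lattice cancels ∧ z and
-- ∨ z jointly.  Hence, by induction on n, a morphism injective on Γ(M) is
-- injective on every [0, n·1], and adding the invertible n·1 moves any two
-- elements into such an interval.  For Ξ, naturality of the isomorphism
-- η : Id ≅ Γ ∘ Ξ makes g injective iff Γ(Ξ g) is, hence iff Ξ g is.
module Submission where

open import Defs
open import Level using (Level; 0ℓ)
open import Data.Nat.Base as ℕ using (ℕ; zero; suc; z≤n; s≤s; _⊔_)
open import Data.Nat.Properties using (m≤m⊔n; m≤n⊔m)
open import Data.Product.Base using (_×_; _,_; proj₁; proj₂; ∃)
open import Function.Bundles using (_⇔_; mk⇔; Func; Inverse; Injection)
open import Function.Construct.Composition using (_⇔-∘_)
open import Function.Construct.Symmetry using (⇔-sym)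
open import Function.Properties.Inverse using (Inverse⇒Injection)
open import Relation.Binary.Core using (Rel)
open import Relation.Binary.Bundles using (Setoid; Poset)
import Relation.Binary.PropositionalEquality as ≡
open import Algebra.Bundles using (CommutativeMonoid)
open import Algebra.Lattice.Bundles using (DistributiveLattice)
open import Algebra.Lattice.Structures using (IsDistributiveLattice)
import Algebra.Lattice.Properties.Lattice as LatticeProperties
import Algebra.Properties.CommutativeMonoid.Mult as Mult
import Algebra.Properties.CommutativeSemigroup as CommutativeSemigroupProperties
import Function.Consequences.Setoid as Consequences
import Relation.Binary.Reasoning.Setoid as ≈-Reasoning
import Relation.Binary.Reasoning.PartialOrder as ≤-Reasoning

module _ {c ℓ : Level} (L : DistributiveLattice c ℓ) where
  open DistributiveLattice L
  open ≈-Reasoning setoid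

  ∧-∨-cancel : ∀ {x y} z → x ∧ z ≈ y ∧ z → x ∨ z ≈ y ∨ z → x ≈ y
  ∧-∨-cancel {x} {y} z ∧-eq ∨-eq = begin
    x                   ≈⟨ sym (∧-absorbs-∨ x z) ⟩
    x ∧ (x ∨ z)         ≈⟨ ∧-cong refl ∨-eq ⟩
    x ∧ (y ∨ z)         ≈⟨ ∧-distribˡ-∨ x y z ⟩
    (x ∧ y) ∨ (x ∧ z)   ≈⟨ ∨-cong (∧-comm x y) ∧-eq ⟩
    (y ∧ x) ∨ (y ∧ z)   ≈⟨ sym (∧-distribˡ-∨ y x z) ⟩
    y ∧ (x ∨ z)         ≈⟨ ∧-cong refl ∨-eq ⟩
    y ∧ (y ∨ z)         ≈⟨ ∧-absorbs-∨ y z ⟩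
    y                   ∎

module _ {c ℓ : Level} (M : CommutativeMonoid c ℓ) where
  open CommutativeMonoid M
  open ≈-Reasoning setoid

  ∙-cancelʳ-invertible : ∀ {u v x y} → u ∙ v ≈ ε → x ∙ v ≈ y ∙ v → x ≈ y
  ∙-cancelʳ-invertible {u} {v} {x} {y} u∙v≈ε x∙v≈y∙v = begin
    x              ≈⟨ sym (identityʳ x) ⟩
    x ∙ ε          ≈⟨ ∙-congˡ ε≈v∙u ⟩
    x ∙ (v ∙ u)    ≈⟨ sym (assoc x v u) ⟩
    (x ∙ v) ∙ u    ≈⟨ ∙-congʳ x∙v≈y∙v ⟩
    (y ∙ v) ∙ u    ≈⟨ assoc y v u ⟩
    y ∙ (v ∙ u)    ≈⟨ ∙-congˡ (sym ε≈v∙u) ⟩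
    y ∙ ε          ≈⟨ identityʳ y ⟩
    y              ∎
    where
    ε≈v∙u : ε ≈ v ∙ u
    ε≈v∙u = sym (trans (comm v u) u∙v≈ε)

module _ {a₁ a₂ b₁ b₂ c₁ c₂ d₁ d₂ : Level}
         {A : Setoid a₁ a₂} {B : Setoid b₁ b₂} {C : Setoid c₁ c₂} {D : Setoid d₁ d₂}
         (g : Func A B) (k : Func C D) (φ : Inverse A C) (ψ : Injection B D) where
  private
    module A = Setoid A
    module B = Setoid B
    module C = Setoid C
    module D = Setoid D
    module g = Func g
    module k = Func k
    module φ = Inverse φ
    module ψ = Injection ψ

  square-injective⇔ : (∀ x → ψ.to (g.to x) D.≈ k.to (φ.to x)) →
                      (∀ x y → g.to x B.≈ g.to y → x A.≈ y) ⇔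
                      (∀ u v → k.to u D.≈ k.to v → u C.≈ v)
  square-injective⇔ square = mk⇔ forward backward
    where
    ψgφ⁻¹≈k : ∀ u → ψ.to (g.to (φ.from u)) D.≈ k.to u
    ψgφ⁻¹≈k u = D.trans (square (φ.from u)) (k.cong (φ.strictlyInverseˡ u))

    forward : (∀ x y → g.to x B.≈ g.to y → x A.≈ y) →
              ∀ u v → k.to u D.≈ k.to v → u C.≈ v
    forward g-injective u v ku≈kv = begin
      u                 ≈⟨ C.sym (φ.strictlyInverseˡ u) ⟩
      φ.to (φ.from u)   ≈⟨ φ.to-cong (g-injective _ _ (ψ.injective ψgu≈ψgv)) ⟩
      φ.to (φ.from v)   ≈⟨ φ.strictlyInverseˡ v ⟩
      v                 ∎
      where
      open ≈-Reasoning C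
      ψgu≈ψgv : ψ.to (g.to (φ.from u)) D.≈ ψ.to (g.to (φ.from v))
      ψgu≈ψgv = D.trans (ψgφ⁻¹≈k u) (D.trans ku≈kv (D.sym (ψgφ⁻¹≈k v)))

    backward : (∀ u v → k.to u D.≈ k.to v → u C.≈ v) →
               ∀ x y → g.to x B.≈ g.to y → x A.≈ y
    backward k-injective x y gx≈gy =
      Injection.injective (Inverse⇒Injection φ)
        (k-injective _ _ (D.trans (D.sym (square x)) (D.trans (ψ.cong gx≈gy) (square y))))

module ULMProperties (M : ULM) where
  open ULM M
  open ULMFacts M

  distributiveLattice : DistributiveLattice 0ℓ 0ℓ
  distributiveLattice = record { isDistributiveLattice = isDistributiveLattice }

  +-commutativeMonoid : CommutativeMonoid 0ℓ 0ℓ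
  +-commutativeMonoid = record { isCommutativeMonoid = +-isCommutativeMonoid }

  open DistributiveLattice distributiveLattice public
    using (refl; sym; trans; ∧-cong; ∨-cong)
  open CommutativeMonoid +-commutativeMonoid public
    using (identityˡ; identityʳ) renaming (∙-cong to +-cong)
  open CommutativeMonoid +-commutativeMonoid using (assoc; commutativeSemigroup)
  open CommutativeSemigroupProperties commutativeSemigroup using (interchange; xy∙z≈y∙zx)
  open Mult +-commutativeMonoid public using () renaming (_×_ to _·_)
  open Mult +-commutativeMonoid using (×-homo-+)
  open Poset (LatticeProperties.poset lattice) using (antisym)
  open ≤-Reasoning (LatticeProperties.poset lattice)

  timesOf≡· : ∀ n a → timesOf _+_ 𝟘 n a ≡.≡ n · a
  timesOf≡· zero    a = ≡.refl
  timesOf≡· (suc n) a = ≡.cong (a +_) (timesOf≡· n a)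

  bounded· : ∀ x → ∃ λ n → (suc n · -𝟙) ≤ x × x ≤ (suc n · 𝟙)
  bounded· x with bounded x
  ... | n , lower , upper =
    n , ≡.subst (_≤ x) (timesOf≡· (suc n) -𝟙) lower
      , ≡.subst (x ≤_) (timesOf≡· (suc n) 𝟙) upper

  ·-nonneg : ∀ {a} → 𝟘 ≤ a → ∀ n → 𝟘 ≤ (n · a)
  ·-nonneg 0≤a zero        = ≤-refl
  ·-nonneg {a} 0≤a (suc n) = begin
    𝟘          ≈⟨ sym (identityʳ 𝟘) ⟩
    𝟘 + 𝟘      ≤⟨ +-mono 0≤a (·-nonneg 0≤a n) ⟩
    a + n · a  ∎

  ·-monoˡ-≤ : ∀ {a m n} → 𝟘 ≤ a → m ℕ.≤ n → (m · a) ≤ (n · a)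
  ·-monoˡ-≤ 0≤a (z≤n {n})     = ·-nonneg 0≤a n
  ·-monoˡ-≤ {a} 0≤a (s≤s m≤n) = +-monoʳ a (·-monoˡ-≤ 0≤a m≤n)

  n·-𝟙+n·𝟙≈𝟘 : ∀ n → n · -𝟙 + n · 𝟙 ≈ 𝟘
  n·-𝟙+n·𝟙≈𝟘 zero    = identityʳ 𝟘
  n·-𝟙+n·𝟙≈𝟘 (suc n) = trans (interchange -𝟙 (n · -𝟙) 𝟙 (n · 𝟙))
    (trans (+-cong -𝟙+𝟙≈𝟘 (n·-𝟙+n·𝟙≈𝟘 n)) (identityʳ 𝟘))

  _∈[𝟘,_] : Carrier → ℕ → Set
  x ∈[𝟘, n ] = 𝟘 ≤ x × x ≤ (n · 𝟙)

  +·𝟙-∈ : ∀ {x m n} → (m · -𝟙) ≤ x → x ≤ (m · 𝟙) → m ℕ.≤ n →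
          (x + n · 𝟙) ∈[𝟘, n ℕ.+ n ]
  +·𝟙-∈ {x} {m} {n} lower upper m≤n =
    (begin
      𝟘                  ≈⟨ sym (n·-𝟙+n·𝟙≈𝟘 m) ⟩
      m · -𝟙 + m · 𝟙     ≤⟨ +-mono lower m·𝟙≤n·𝟙 ⟩
      x + n · 𝟙          ∎)
    , (begin
      x + n · 𝟙          ≤⟨ +-monoˡ (n · 𝟙) (≤-trans upper m·𝟙≤n·𝟙) ⟩
      n · 𝟙 + n · 𝟙      ≈⟨ sym (×-homo-+ 𝟙 n n) ⟩
      (n ℕ.+ n) · 𝟙      ∎)
    where
    m·𝟙≤n·𝟙 : (m · 𝟙) ≤ (n · 𝟙)
    m·𝟙≤n·𝟙 = ·-monoˡ-≤ 𝟘≤𝟙 m≤n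

  ∧𝟙-∈I : ∀ {x} → 𝟘 ≤ x → I (x ∧ 𝟙)
  ∧𝟙-∈I {x} 0≤x = ∧-greatest 0≤x 𝟘≤𝟙 , x∧y≤y x 𝟙

  _∸𝟙 : Carrier → Carrier
  x ∸𝟙 = (x + -𝟙) ∨ 𝟘

  ∸𝟙-cong : ∀ {x y} → x ≈ y → x ∸𝟙 ≈ y ∸𝟙
  ∸𝟙-cong x≈y = ∨-cong (+-cong x≈y refl) refl

  ∸𝟙-∈ : ∀ {x n} → x ∈[𝟘, suc n ] → x ∸𝟙 ∈[𝟘, n ]
  ∸𝟙-∈ {x} {n} (_ , upper) = y≤x∨y (x + -𝟙) 𝟘 , ∨-least x-𝟙≤n·𝟙 (·-nonneg 𝟘≤𝟙 n)
    where
    x-𝟙≤n·𝟙 : (x + -𝟙) ≤ (n · 𝟙)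
    x-𝟙≤n·𝟙 = begin
      x + -𝟙                ≤⟨ +-monoˡ -𝟙 upper ⟩
      (𝟙 + n · 𝟙) + -𝟙      ≈⟨ xy∙z≈y∙zx 𝟙 (n · 𝟙) -𝟙 ⟩
      n · 𝟙 + (-𝟙 + 𝟙)      ≈⟨ +-cong refl -𝟙+𝟙≈𝟘 ⟩
      n · 𝟙 + 𝟘             ≈⟨ identityʳ (n · 𝟙) ⟩
      n · 𝟙                 ∎

  ∸𝟙+𝟙≈∨𝟙 : ∀ x → x ∸𝟙 + 𝟙 ≈ x ∨ 𝟙
  ∸𝟙+𝟙≈∨𝟙 x = trans (proj₂ +-distrib-∨ 𝟙 (x + -𝟙) 𝟘) (∨-cong x-𝟙+𝟙≈x (identityˡ 𝟙))
    where
    x-𝟙+𝟙≈x : x + -𝟙 + 𝟙 ≈ x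
    x-𝟙+𝟙≈x = trans (assoc x -𝟙 𝟙) (trans (+-cong refl -𝟙+𝟙≈𝟘) (identityʳ x))

  ∈[𝟘,0]⇒≈𝟘 : ∀ {x} → x ∈[𝟘, 0 ] → x ≈ 𝟘
  ∈[𝟘,0]⇒≈𝟘 (0≤x , x≤0) = antisym x≤0 0≤x

module _ {M N : ULM} (f : ULMHom M N) where
  open ULM M
  open ULMFacts M using (I)
  open ULMProperties M
  open ULMHom f
  private
    module N = ULMProperties N
    infix 4 _≈ᴺ_
    _≈ᴺ_ : Rel (ULM.Carrier N) 0ℓ
    _≈ᴺ_ = ULM._≈_ N

  InjectiveOn : (Carrier → Set) → Set
  InjectiveOn P = ∀ {x y} → P x → P y → ⟦ x ⟧ ≈ᴺ ⟦ y ⟧ → x ≈ y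

  ⟦∸𝟙⟧ : ∀ x → ⟦ x ∸𝟙 ⟧ ≈ᴺ ⟦ x ⟧ N.∸𝟙
  ⟦∸𝟙⟧ x = N.trans (pres-∨ _ _)
    (N.∨-cong (N.trans (pres-+ x -𝟙) (N.+-cong N.refl pres--𝟙)) pres-𝟘)

  injectiveOn-I⇒injectiveOn-[𝟘,n] : InjectiveOn I → ∀ n → InjectiveOn (_∈[𝟘, n ])
  injectiveOn-I⇒injectiveOn-[𝟘,n] injective-I zero x∈ y∈ _ =
    trans (∈[𝟘,0]⇒≈𝟘 x∈) (sym (∈[𝟘,0]⇒≈𝟘 y∈))
  injectiveOn-I⇒injectiveOn-[𝟘,n] injective-I (suc n) {x} {y} x∈ y∈ fx≈fy =
    ∧-∨-cancel distributiveLattice 𝟙 x∧𝟙≈y∧𝟙 x∨𝟙≈y∨𝟙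
    where
    x∧𝟙≈y∧𝟙 : x ∧ 𝟙 ≈ y ∧ 𝟙
    x∧𝟙≈y∧𝟙 = injective-I (∧𝟙-∈I (proj₁ x∈)) (∧𝟙-∈I (proj₁ y∈))
      (N.trans (pres-∧ x 𝟙) (N.trans (N.∧-cong fx≈fy N.refl) (N.sym (pres-∧ y 𝟙))))

    x∸𝟙≈y∸𝟙 : x ∸𝟙 ≈ y ∸𝟙
    x∸𝟙≈y∸𝟙 = injectiveOn-I⇒injectiveOn-[𝟘,n] injective-I n (∸𝟙-∈ {n = n} x∈) (∸𝟙-∈ {n = n} y∈)
      (N.trans (⟦∸𝟙⟧ x) (N.trans (N.∸𝟙-cong fx≈fy) (N.sym (⟦∸𝟙⟧ y))))

    x∨𝟙≈y∨𝟙 : x ∨ 𝟙 ≈ y ∨ 𝟙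
    x∨𝟙≈y∨𝟙 = trans (sym (∸𝟙+𝟙≈∨𝟙 x)) (trans (+-cong x∸𝟙≈y∸𝟙 refl) (∸𝟙+𝟙≈∨𝟙 y))

  injectiveOn-[𝟘,n]⇒injective : (∀ n → InjectiveOn (_∈[𝟘, n ])) → ULMInjective f
  injectiveOn-[𝟘,n]⇒injective injective-[𝟘,n] x y fx≈fy with bounded· x | bounded· y
  ... | m , x-lower , x-upper | m′ , y-lower , y-upper =
    ∙-cancelʳ-invertible +-commutativeMonoid (n·-𝟙+n·𝟙≈𝟘 K)
      (injective-[𝟘,n] (K ℕ.+ K)
        (+·𝟙-∈ x-lower x-upper (s≤s (m≤m⊔n m m′)))
        (+·𝟙-∈ y-lower y-upper (s≤s (m≤n⊔m m m′)))
        (N.trans (pres-+ x _) (N.trans (N.+-cong fx≈fy N.refl) (N.sym (pres-+ y _)))))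
    where
    K : ℕ
    K = suc (m ⊔ m′)

  injective⇔Γ-injective : ULMInjective f ⇔ MVMInjective (Γhom f)
  injective⇔Γ-injective = mk⇔
    (λ injective a b → injective (proj₁ a) (proj₁ b))
    (λ Γ-injective → injectiveOn-[𝟘,n]⇒injective
      (injectiveOn-I⇒injectiveOn-[𝟘,n] (λ {x} {y} x∈I y∈I → Γ-injective (x , x∈I) (y , y∈I))))

mvmSetoid : MVMAlg → Setoid 0ℓ 0ℓ
mvmSetoid A = record
  { isEquivalence =
      IsDistributiveLattice.isEquivalence (IsMVM.isDistributiveLattice (MVMAlg.isMVM A)) }

mvmFunc : {A B : MVMAlg} → MVMHom (MVMAlg.sig A) (MVMAlg.sig B) → Func (mvmSetoid A) (mvmSetoid B)
mvmFunc g = record { to = MVMHom.⟦ g ⟧ ; cong = MVMHom.cong g }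

module _ {ΓisMVM : (M : ULM) → IsMVM (ΓSig M)} (Ξ : QuasiInverse ΓisMVM) where
  open QuasiInverse Ξ

  η-inverse : (A : MVMAlg) → Inverse (mvmSetoid A) (mvmSetoid (ΓAlg ΓisMVM (obj A)))
  η-inverse A = record
    { to        = MVMHom.⟦ η A ⟧
    ; from      = MVMHom.⟦ η⁻¹ A ⟧
    ; to-cong   = MVMHom.cong (η A)
    ; from-cong = MVMHom.cong (η⁻¹ A)
    ; inverse   = strictlyInverseˡ⇒inverseˡ {f = MVMHom.⟦ η A ⟧} {f⁻¹ = MVMHom.⟦ η⁻¹ A ⟧} (MVMHom.cong (η A)) (η∘η⁻¹ A)
                , strictlyInverseʳ⇒inverseʳ {f⁻¹ = MVMHom.⟦ η⁻¹ A ⟧} {f = MVMHom.⟦ η A ⟧} (MVMHom.cong (η⁻¹ A)) (η⁻¹∘η A)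
    }
    where open Consequences (mvmSetoid A) (mvmSetoid (ΓAlg ΓisMVM (obj A)))

  injective⇔ΓΞ-injective : {A B : MVMAlg} (g : MVMHom (MVMAlg.sig A) (MVMAlg.sig B)) →
                           MVMInjective g ⇔ MVMInjective (Γhom (hom {A} {B} g))
  injective⇔ΓΞ-injective {A} {B} g =
    square-injective⇔ (mvmFunc {A} {B} g) (mvmFunc {ΓAlg ΓisMVM (obj A)} {ΓAlg ΓisMVM (obj B)} (Γhom (hom g)))
      (η-inverse A) (Inverse⇒Injection (η-inverse B)) (η-natural {A} {B} g)

proposition3p5 : (ΓisMVM : (M : ULM) → IsMVM (ΓSig M))
                 (Ξ : QuasiInverse ΓisMVM) →
                 ((M N : ULM) (f : ULMHom M N) →
                    ULMInjective f ⇔ MVMInjective (Γhom f))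
                 × ((A B : MVMAlg) (g : MVMHom (MVMAlg.sig A) (MVMAlg.sig B)) →
                    MVMInjective g ⇔ ULMInjective (QuasiInverse.hom Ξ {A} {B} g))
proposition3p5 ΓisMVM Ξ =
    (λ M N f → injective⇔Γ-injective f)
  , λ A B g → ⇔-sym (injective⇔Γ-injective (QuasiInverse.hom Ξ g)) ⇔-∘ injective⇔ΓΞ-injective Ξ g
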